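{- Let $x,z$ be formal variables and define rational functions $G_n(w)$ for $n\ge1$ by $G_1(w)=\frac1w$ and, for $n\ge2$, $$G_n(w)=\sum_{k=1}^{n-1}\frac{G_k(w)\,G_{n-k}(w+kz)}{w+(n-1)x}.$$ For integers $1\le k<n$ define $F_{k,n}(w)$ by $F_{1,n}(w)=G_n(w)$ and, for $k\ge2$, $$F_{k,n}(w)=\sum_{i=1}^{n-k-1}\frac{G_{n-k-i}(w+(k+i)z)\,F_{k,k+i}(w)}{w+(n-1)x}+\sum_{i=1}^{k-1}\frac{(w+iz)\,G_i(w+x)\,F_{k-i,n-i}(w+iz)}{w\,(w+(n-1)x)}.$$ Then for all integers $k,n$ with $1\le k\le n-2$, $$F_{k,n}(w)-F_{k+1,n}(w)=\frac{G_k(w+x)\,G_{n-k}(w+kz)}{w}.$$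
   Context: All functions are rational functions in $w,x,z$, with $x$ and $z$ treated as constant formal variables and $w$ as the argument. -}

module Defs where

open import Data.Nat as ℕ using (ℕ; zero; suc; _∸_)
open import Data.Integer using (+_)
open import Data.Rational using (ℚ; _+_; _*_; _-_; 0ℚ; 1ℚ) renaming (_/_ to _//_)
open import Relation.Binary.PropositionalEquality using (_≡_)

-- Rational functions in w, x, z over ℚ, represented as fractions num/den
-- of (polynomial) functions of (w , x , z).  Every fraction built below has
-- numerator and denominator obtained by ring operations from w, x, z, and
-- constants, i.e. they are polynomials; denominators are products of linear
-- forms  w + a x + b z  (nonzero polynomials).

Fn : Set
Fn = ℚ → ℚ → ℚ → ℚ

record RatFun : Set where
  constructor _/ᶠ_
  field
    num : Fn
    den : Fn
open RatFun public

nat : ℕ → ℚ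
nat n = (+ n) // 1

-- equality of rational functions (p/q = r/s iff p s = r q as polynomials;
-- polynomials over the infinite field ℚ are equal iff equal as functions)
infix 4 _≈_
_≈_ : RatFun → RatFun → Set
P ≈ Q = ∀ w x z → num P w x z * den Q w x z ≡ num Q w x z * den P w x z

infixl 6 _⊕_ _⊖_
infixl 7 _⊗_ _⊘_

_⊕_ : RatFun → RatFun → RatFun
P ⊕ Q = (λ w x z → num P w x z * den Q w x z + num Q w x z * den P w x z)
     /ᶠ (λ w x z → den P w x z * den Q w x z)

_⊖_ : RatFun → RatFun → RatFun
P ⊖ Q = (λ w x z → num P w x z * den Q w x z - num Q w x z * den P w x z)
     /ᶠ (λ w x z → den P w x z * den Q w x z)

_⊗_ : RatFun → RatFun → RatFun
P ⊗ Q = (λ w x z → num P w x z * num Q w x z)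
     /ᶠ (λ w x z → den P w x z * den Q w x z)

-- division (only used with nonzero-polynomial divisors)
_⊘_ : RatFun → RatFun → RatFun
P ⊘ Q = (λ w x z → num P w x z * den Q w x z)
     /ᶠ (λ w x z → den P w x z * num Q w x z)

zeroR : RatFun
zeroR = (λ _ _ _ → 0ℚ) /ᶠ (λ _ _ _ → 1ℚ)

oneR : RatFun
oneR = (λ _ _ _ → 1ℚ) /ᶠ (λ _ _ _ → 1ℚ)

lin : ℕ → ℕ → RatFun
lin a b = (λ w x z → w + nat a * x + nat b * z) /ᶠ (λ _ _ _ → 1ℚ)

W : RatFun
W = lin 0 0

shift : ℕ → ℕ → RatFun → RatFun
shift a b P = (λ w x z → num P (w + nat a * x + nat b * z) x z)
           /ᶠ (λ w x z → den P (w + nat a * x + nat b * z) x z)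

sumR : ℕ → (ℕ → RatFun) → RatFun
sumR zero    f = zeroR
sumR (suc m) f = sumR m f ⊕ f (suc m)

-- G with fuel: Gf f n is G_n whenever f ≥ n ≥ 1 (junk otherwise)
Gf : ℕ → ℕ → RatFun
Gf zero    n = zeroR
Gf (suc f) zero = zeroR
Gf (suc f) (suc zero) = oneR ⊘ W
Gf (suc f) (suc (suc m)) =
  let n = suc (suc m) in
  sumR (n ∸ 1) (λ k → (Gf f k ⊗ shift 0 k (Gf f (n ∸ k))) ⊘ lin (n ∸ 1) 0)

G : ℕ → RatFun
G n = Gf n n

-- F with fuel: Ff f k n is F_{k,n} whenever f ≥ n and 1 ≤ k < n
Ff : ℕ → ℕ → ℕ → RatFun
Ff zero    k n = zeroR
Ff (suc f) zero n = zeroR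
Ff (suc f) (suc zero) n = G n
Ff (suc f) (suc (suc j)) n =
  let k = suc (suc j) in
  sumR (n ∸ k ∸ 1)
       (λ i → (shift 0 (k ℕ.+ i) (G (n ∸ k ∸ i)) ⊗ Ff f k (k ℕ.+ i)) ⊘ lin (n ∸ 1) 0)
  ⊕ sumR (k ∸ 1)
       (λ i → (lin 0 i ⊗ shift 1 0 (G i) ⊗ shift 0 i (Ff f (k ∸ i) (n ∸ i)))
              ⊘ (W ⊗ lin (n ∸ 1) 0))

F : ℕ → ℕ → RatFun
F k n = Ff n k n

{-# OPTIONS --safe #-}
-- Cross-multiplied, the identity says that a polynomial in w vanishes. A polynomial of degree ≤ d
-- that vanishes at w₀ + h, …, w₀ + (d + 1) h vanishes at w₀ (finite differences), and h can be chosen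
-- so large that at all these points no linear form w + a x + b z of the relevant size vanishes. At such
-- regular points G_n and F_{k,n} are honest rationals satisfying their recursions, and there the identity
-- follows by strong induction on n: the difference F_{k,n} − F_{k+1,n} is split along the two sums of
-- the recursion for F, the induction hypothesis collapses the termwise differences, and the recursion
-- for G reassembles what is left into G_k(w + x) G_{n−k}(w + k z) / w.
module Submission where

open import Defs
open import Data.Rational using (ℚ)

module RationalArithmetic where
  open import Data.Nat as ℕ using (ℕ; zero; suc)
  import Data.Nat.Properties as ℕ
  import Data.Nat.Coprimality as Coprime
  import Data.Integer as ℤ
  import Data.Integer.Properties as ℤ
  open import Data.Empty using (⊥-elim)
  open import Data.Rational using (ℚ; mkℚ; 0ℚ; 1ℚ; _+_; _-_; _*_; 1/_; _≟_; ≢-nonZero)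
  open import Data.Rational.Properties
  open import Data.Rational.Solver using (module +-*-Solver)
  open import Relation.Binary.PropositionalEquality
  open import Relation.Nullary using (Dec; yes; no)
  open +-*-Solver

  nat-mkℚ : ∀ n → nat n ≡ mkℚ (ℤ.+ n) 0 (Coprime.sym (Coprime.1-coprimeTo n))
  nat-mkℚ n = normalize-coprime (Coprime.sym (Coprime.1-coprimeTo n))

  nat-+ : ∀ m n → nat (m ℕ.+ n) ≡ nat m + nat n
  nat-+ m n = sym (trans (cong₂ _+_ (nat-mkℚ m) (nat-mkℚ n))
                         (/-cong (cong₂ ℤ._+_ (ℤ.*-identityʳ (ℤ.+ m)) (ℤ.*-identityʳ (ℤ.+ n))) refl))

  -- A total inverse; the junk value inv 0ℚ = 0ℚ makes inv-* hold unconditionally.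
  inv : ℚ → ℚ
  inv q with q ≟ 0ℚ
  ... | yes _  = 0ℚ
  ... | no q≢0 = (1/ q) {{≢-nonZero q≢0}}

  inv-inverseʳ : ∀ q → q ≢ 0ℚ → q * inv q ≡ 1ℚ
  inv-inverseʳ q q≢0 with q ≟ 0ℚ
  ... | yes q≡0 = ⊥-elim (q≢0 q≡0)
  ... | no q≢0′ = *-inverseʳ q {{≢-nonZero q≢0′}}

  *-cancelˡ-inv : ∀ a b → a ≢ 0ℚ → a * (b * inv a) ≡ b
  *-cancelˡ-inv a b a≢0 = begin
    a * (b * inv a)  ≡⟨ solve 3 (λ a b i → a :* (b :* i) := b :* (a :* i)) refl a b (inv a) ⟩
    b * (a * inv a)  ≡⟨ cong (b *_) (inv-inverseʳ a a≢0) ⟩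
    b * 1ℚ           ≡⟨ *-identityʳ b ⟩
    b                ∎
    where open ≡-Reasoning

  *-≢0 : ∀ {a b} → a ≢ 0ℚ → b ≢ 0ℚ → a * b ≢ 0ℚ
  *-≢0 {a} {b} a≢0 b≢0 ab≡0 = a≢0 (begin
    a                ≡⟨ sym (*-cancelˡ-inv b a b≢0) ⟩
    b * (a * inv b)  ≡⟨ solve 3 (λ b a i → b :* (a :* i) := (a :* b) :* i) refl b a (inv b) ⟩
    (a * b) * inv b  ≡⟨ cong (_* inv b) ab≡0 ⟩
    0ℚ * inv b       ≡⟨ *-zeroˡ (inv b) ⟩
    0ℚ               ∎)
    where open ≡-Reasoning

  inv-unique : ∀ a c → a ≢ 0ℚ → a * c ≡ 1ℚ → inv a ≡ c
  inv-unique a c a≢0 ac≡1 = begin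
    inv a              ≡⟨ sym (*-identityʳ (inv a)) ⟩
    inv a * 1ℚ         ≡⟨ cong (inv a *_) (sym ac≡1) ⟩
    inv a * (a * c)    ≡⟨ solve 3 (λ i a c → i :* (a :* c) := (a :* i) :* c) refl (inv a) a c ⟩
    (a * inv a) * c    ≡⟨ cong (_* c) (inv-inverseʳ a a≢0) ⟩
    1ℚ * c             ≡⟨ *-identityˡ c ⟩
    c                  ∎
    where open ≡-Reasoning

  inv-* : ∀ a b → inv (a * b) ≡ inv a * inv b
  inv-* a b = by-cases (a ≟ 0ℚ) (b ≟ 0ℚ)
    where
    open ≡-Reasoning
    by-cases : Dec (a ≡ 0ℚ) → Dec (b ≡ 0ℚ) → inv (a * b) ≡ inv a * inv b
    by-cases (yes a≡0) _ = begin
      inv (a * b)      ≡⟨ cong (λ t → inv (t * b)) a≡0 ⟩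
      inv (0ℚ * b)     ≡⟨ cong inv (*-zeroˡ b) ⟩
      0ℚ               ≡⟨ sym (*-zeroˡ (inv b)) ⟩
      0ℚ * inv b       ≡⟨ cong (λ t → inv t * inv b) (sym a≡0) ⟩
      inv a * inv b    ∎
    by-cases (no _) (yes b≡0) = begin
      inv (a * b)      ≡⟨ cong (λ t → inv (a * t)) b≡0 ⟩
      inv (a * 0ℚ)     ≡⟨ cong inv (*-zeroʳ a) ⟩
      0ℚ               ≡⟨ sym (*-zeroʳ (inv a)) ⟩
      inv a * 0ℚ       ≡⟨ cong (λ t → inv a * inv t) (sym b≡0) ⟩
      inv a * inv b    ∎
    by-cases (no a≢0) (no b≢0) = inv-unique (a * b) (inv a * inv b) (*-≢0 a≢0 b≢0) (begin
      (a * b) * (inv a * inv b)  ≡⟨ solve 4 (λ a b c d → (a :* b) :* (c :* d) := (a :* c) :* (b :* d)) refl a b (inv a) (inv b) ⟩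
      (a * inv a) * (b * inv b)  ≡⟨ cong₂ _*_ (inv-inverseʳ a a≢0) (inv-inverseʳ b b≢0) ⟩
      1ℚ * 1ℚ                    ≡⟨ *-identityˡ 1ℚ ⟩
      1ℚ                         ∎)

  sumℚ : ℕ → (ℕ → ℚ) → ℚ
  sumℚ zero    f = 0ℚ
  sumℚ (suc m) f = sumℚ m f + f (suc m)

  sumℚ-cong : ∀ m {f g} → (∀ i → 1 ℕ.≤ i → i ℕ.≤ m → f i ≡ g i) → sumℚ m f ≡ sumℚ m g
  sumℚ-cong zero    f≗g = refl
  sumℚ-cong (suc m) f≗g = cong₂ _+_ (sumℚ-cong m (λ i 1≤i i≤m → f≗g i 1≤i (ℕ.m≤n⇒m≤1+n i≤m)))
                                    (f≗g (suc m) (ℕ.s≤s ℕ.z≤n) ℕ.≤-refl)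

  sumℚ-suc : ∀ m f → sumℚ (suc m) f ≡ f 1 + sumℚ m (λ i → f (suc i))
  sumℚ-suc zero    f = trans (+-identityˡ (f 1)) (sym (+-identityʳ (f 1)))
  sumℚ-suc (suc m) f = trans (cong (_+ f (suc (suc m))) (sumℚ-suc m f)) (+-assoc (f 1) _ _)

  sumℚ-sub : ∀ m f g → sumℚ m f - sumℚ m g ≡ sumℚ m (λ i → f i - g i)
  sumℚ-sub zero    f g = refl
  sumℚ-sub (suc m) f g = trans
    (solve 4 (λ a b c d → (a :+ b) :- (c :+ d) := (a :- c) :+ (b :- d)) refl (sumℚ m f) (f (suc m)) (sumℚ m g) (g (suc m)))
    (cong (_+ (f (suc m) - g (suc m))) (sumℚ-sub m f g))

  sumℚ-*ʳ : ∀ m f c → sumℚ m (λ i → f i * c) ≡ sumℚ m f * c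
  sumℚ-*ʳ zero    f c = sym (*-zeroˡ c)
  sumℚ-*ʳ (suc m) f c = trans (cong (_+ f (suc m) * c) (sumℚ-*ʳ m f c)) (sym (*-distribʳ-+ c (sumℚ m f) (f (suc m))))

module Polynomials where
  open import Data.Nat as ℕ using (ℕ; zero; suc; z≤n; s≤s)
  import Data.Nat.Properties as ℕ
  open import Data.Product using (Σ; _,_)
  open import Data.Rational using (ℚ; 0ℚ; 1ℚ; _+_; _-_; _*_; -_)
  open import Data.Rational.Properties using (+-inverseʳ; *-zeroʳ; *-identityˡ)
  open import Data.Rational.Solver using (module +-*-Solver)
  open import Relation.Binary.PropositionalEquality
  open +-*-Solver
  open RationalArithmetic

  -- Degree via iterated finite differences, so that no coefficients are needed.
  DegreeAtMost : ℕ → (ℚ → ℚ) → Set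
  DegreeAtMost zero    f = ∀ h w → f (w + h) ≡ f w
  DegreeAtMost (suc d) f = ∀ h → DegreeAtMost d (λ w → f (w + h) - f w)

  IsPolynomial : (ℚ → ℚ) → Set
  IsPolynomial f = Σ ℕ λ d → DegreeAtMost d f

  degree-cong : ∀ d {f g} → (∀ w → f w ≡ g w) → DegreeAtMost d f → DegreeAtMost d g
  degree-cong zero    f≗g df h w = trans (sym (f≗g (w + h))) (trans (df h w) (f≗g w))
  degree-cong (suc d) f≗g df h = degree-cong d (λ w → cong₂ _-_ (f≗g (w + h)) (f≗g w)) (df h)

  degree-const : ∀ d c → DegreeAtMost d (λ _ → c)
  degree-const zero    c h w = refl
  degree-const (suc d) c h = degree-cong d (λ _ → sym (+-inverseʳ c)) (degree-const d 0ℚ)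

  degree-suc : ∀ d {f} → DegreeAtMost d f → DegreeAtMost (suc d) f
  degree-suc zero {f} df h =
    degree-cong zero (λ w → sym (trans (cong (_- f w) (df h w)) (+-inverseʳ (f w)))) (degree-const zero 0ℚ)
  degree-suc (suc d) df h = degree-suc d (df h)

  degree-mono : ∀ {d e f} → d ℕ.≤ e → DegreeAtMost d f → DegreeAtMost e f
  degree-mono {e = zero}  z≤n     df = df
  degree-mono {e = suc e} z≤n     df = degree-suc e (degree-mono z≤n df)
  degree-mono             (s≤s le) df h = degree-mono le (df h)

  degree-+ : ∀ d {f g} → DegreeAtMost d f → DegreeAtMost d g → DegreeAtMost d (λ w → f w + g w)
  degree-+ zero    df dg h w = cong₂ _+_ (df h w) (dg h w)
  degree-+ (suc d) {f} {g} df dg h = degree-cong d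
    (λ w → solve 4 (λ a b c e → (a :- c) :+ (b :- e) := (a :+ b) :- (c :+ e)) refl
                   (f (w + h)) (g (w + h)) (f w) (g w))
    (degree-+ d (df h) (dg h))

  degree-neg : ∀ d {f} → DegreeAtMost d f → DegreeAtMost d (λ w → - f w)
  degree-neg zero    df h w = cong -_ (df h w)
  degree-neg (suc d) {f} df h = degree-cong d
    (λ w → solve 2 (λ a c → :- (a :- c) := (:- a) :- (:- c)) refl (f (w + h)) (f w))
    (degree-neg d (df h))

  degree-shift : ∀ d {f} c → DegreeAtMost d f → DegreeAtMost d (λ w → f (w + c))
  degree-shift zero    {f} c df h w =
    trans (cong f (solve 3 (λ w h c → (w :+ h) :+ c := (w :+ c) :+ h) refl w h c)) (df h (w + c))
  degree-shift (suc d) {f} c df h = degree-cong d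
    (λ w → cong (λ t → f t - f (w + c)) (solve 3 (λ w c h → (w :+ c) :+ h := (w :+ h) :+ c) refl w c h))
    (degree-shift d c (df h))

  degree-* : ∀ d e {f g} → DegreeAtMost d f → DegreeAtMost e g → DegreeAtMost (d ℕ.+ e) (λ w → f w * g w)
  degree-* zero zero df dg h w = cong₂ _*_ (df h w) (dg h w)
  degree-* zero (suc e) {f} {g} df dg h = degree-cong e
    (λ w → trans (solve 3 (λ a c b → a :* (c :- b) := a :* c :- a :* b) refl (f w) (g (w + h)) (g w))
                 (cong (λ t → t * g (w + h) - f w * g w) (sym (df h w))))
    (degree-* zero e df (dg h))
  degree-* (suc d) e {f} {g} df dg h = degree-cong (d ℕ.+ e)
    (λ w → solve 4 (λ a b c u → (a :- b) :* c :+ b :* (c :- u) := a :* c :- b :* u) refl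
                   (f (w + h)) (f w) (g (w + h)) (g w))
    (degree-+ (d ℕ.+ e) (degree-* d e (df h) (degree-shift e h dg)) (Δfg e dg))
    where
    Δfg : ∀ e {g} → DegreeAtMost e g → DegreeAtMost (d ℕ.+ e) (λ w → f w * (g (w + h) - g w))
    Δfg zero {g} dg = degree-cong (d ℕ.+ 0) (λ w → sym (trans (cong (λ t → f w * (t - g w)) (dg h w))
                                                            (trans (cong (f w *_) (+-inverseʳ (g w))) (*-zeroʳ (f w)))))
                                            (degree-const (d ℕ.+ 0) 0ℚ)
    Δfg (suc e) {g} dg = subst (λ m → DegreeAtMost m (λ w → f w * (g (w + h) - g w))) (sym (ℕ.+-suc d e))
                               (degree-* (suc d) e {f} {λ w → g (w + h) - g w} df (dg h))

  polynomial-cong : ∀ {f g} → (∀ w → f w ≡ g w) → IsPolynomial f → IsPolynomial g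
  polynomial-cong f≗g (d , df) = d , degree-cong d f≗g df

  polynomial-const : ∀ c → IsPolynomial (λ _ → c)
  polynomial-const c = 0 , degree-const 0 c

  polynomial-id : IsPolynomial (λ w → w)
  polynomial-id = 1 , λ h → degree-cong 0 (λ w → solve 2 (λ w h → h := (w :+ h) :- w) refl w h) (degree-const 0 h)

  polynomial-+ : ∀ {f g} → IsPolynomial f → IsPolynomial g → IsPolynomial (λ w → f w + g w)
  polynomial-+ (d , df) (e , dg) =
    d ℕ.⊔ e , degree-+ (d ℕ.⊔ e) (degree-mono (ℕ.m≤m⊔n d e) df) (degree-mono (ℕ.m≤n⊔m d e) dg)

  polynomial-sub : ∀ {f g} → IsPolynomial f → IsPolynomial g → IsPolynomial (λ w → f w - g w)
  polynomial-sub pf (e , dg) = polynomial-+ pf (e , degree-neg e dg)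

  polynomial-* : ∀ {f g} → IsPolynomial f → IsPolynomial g → IsPolynomial (λ w → f w * g w)
  polynomial-* (d , df) (e , dg) = d ℕ.+ e , degree-* d e df dg

  polynomial-shift : ∀ {f} c → IsPolynomial f → IsPolynomial (λ w → f (w + c))
  polynomial-shift c (d , df) = d , degree-shift d c df

  -- Zeros at w₀ + h, …, w₀ + (d + 1) h force a zero at w₀, because f w₀ = f (w₀ + h) − Δₕ f w₀
  -- and Δₕ f has degree ≤ d − 1 and vanishes at the first d of these points.
  progression-zeros⇒zero : ∀ d {f} w₀ h → DegreeAtMost d f →
    (∀ j → 1 ℕ.≤ j → j ℕ.≤ suc d → f (w₀ + nat j * h) ≡ 0ℚ) → f w₀ ≡ 0ℚ
  progression-zeros⇒zero zero {f} w₀ h df zeros =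
    trans (sym (df h w₀)) (trans (cong (λ t → f (w₀ + t)) (sym (*-identityˡ h))) (zeros 1 (s≤s z≤n) (s≤s z≤n)))
  progression-zeros⇒zero (suc d) {f} w₀ h df zeros = begin
    f w₀                              ≡⟨ solve 2 (λ a b → b := a :- (a :- b)) refl (f (w₀ + h)) (f w₀) ⟩
    f (w₀ + h) - (f (w₀ + h) - f w₀)  ≡⟨ cong₂ _-_ first-zero (progression-zeros⇒zero d w₀ h (df h) Δ-zeros) ⟩
    0ℚ - 0ℚ                           ≡⟨ +-inverseʳ 0ℚ ⟩
    0ℚ                                ∎
    where
    open ≡-Reasoning
    first-zero : f (w₀ + h) ≡ 0ℚ
    first-zero = trans (cong (λ t → f (w₀ + t)) (sym (*-identityˡ h))) (zeros 1 (s≤s z≤n) (s≤s z≤n))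
    Δ-zeros : ∀ j → 1 ℕ.≤ j → j ℕ.≤ suc d → f (w₀ + nat j * h + h) - f (w₀ + nat j * h) ≡ 0ℚ
    Δ-zeros j 1≤j j≤d+1 = trans (cong₂ _-_ (trans (cong f next-point) (zeros (suc j) (s≤s z≤n) (s≤s j≤d+1)))
                                         (zeros j 1≤j (ℕ.m≤n⇒m≤1+n j≤d+1)))
                               (+-inverseʳ 0ℚ)
      where
      next-point : w₀ + nat j * h + h ≡ w₀ + nat (suc j) * h
      next-point = trans (solve 3 (λ w j h → w :+ j :* h :+ h := w :+ (con 1ℚ :+ j) :* h) refl w₀ (nat j) h)
                         (cong (λ t → w₀ + t * h) (sym (nat-+ 1 j)))

module Evaluation (x z : ℚ) where
  open import Data.Nat as ℕ using (ℕ; zero; suc; z≤n; s≤s; _∸_)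
  import Data.Nat.Properties as ℕ
  open import Data.Product using (Σ; _,_; _×_; proj₁; proj₂)
  open import Data.Sum using (inj₁; inj₂)
  open import Data.Rational using (ℚ; 0ℚ; 1ℚ; _+_; _-_; _*_; ∣_∣; NonNegative; Positive)
  open import Data.Rational.Properties
  open import Data.Rational.Solver using (module +-*-Solver)
  open import Algebra.Properties.Group +-0-group using (x∙y⁻¹≈ε⇒x≈y)
  open import Relation.Binary.PropositionalEquality
  open import Data.Nat.Tactic.RingSolver using (solve-∀)
  open +-*-Solver
  open RationalArithmetic
  open Polynomials

  ℓ : ℕ → ℕ → ℚ → ℚ
  ℓ a b w = w + nat a * x + nat b * z

  ℓ-ℓ : ∀ a b c d w → ℓ a b (ℓ c d w) ≡ ℓ (c ℕ.+ a) (d ℕ.+ b) w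
  ℓ-ℓ a b c d w = trans
    (solve 7 (λ w a b c d x z → w :+ c :* x :+ d :* z :+ a :* x :+ b :* z := w :+ (c :+ a) :* x :+ (d :+ b) :* z) refl
             w (nat a) (nat b) (nat c) (nat d) x z)
    (sym (cong₂ (λ s t → w + s * x + t * z) (nat-+ c a) (nat-+ d b)))

  ℓ-0-0 : ∀ w → ℓ 0 0 w ≡ w
  ℓ-0-0 w = solve 3 (λ w x z → w :+ con 0ℚ :* x :+ con 0ℚ :* z := w) refl w x z

  record Regular (N : ℕ) (w : ℚ) : Set where
    constructor regular
    field ℓ≢0 : ∀ a b → a ℕ.+ b ℕ.≤ N → ℓ a b w ≢ 0ℚ
  open Regular public

  regular-mono : ∀ {M N w} → M ℕ.≤ N → Regular N w → Regular M w
  regular-mono M≤N reg = regular λ a b a+b≤M → ℓ≢0 reg a b (ℕ.≤-trans a+b≤M M≤N)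

  regular-ℓ : ∀ a b {M N w} → a ℕ.+ b ℕ.+ M ℕ.≤ N → Regular N w → Regular M (ℓ a b w)
  regular-ℓ a b {M} {N} {w} ≤N reg = regular λ c d c+d≤M ℓ≡0 →
    ℓ≢0 reg (a ℕ.+ c) (b ℕ.+ d) (bound c d c+d≤M) (trans (sym (ℓ-ℓ c d a b w)) ℓ≡0)
    where
    bound : ∀ c d → c ℕ.+ d ℕ.≤ M → a ℕ.+ c ℕ.+ (b ℕ.+ d) ℕ.≤ N
    bound c d c+d≤M = ℕ.≤-trans (ℕ.≤-reflexive (interchange a c b d)) (ℕ.≤-trans (ℕ.+-monoʳ-≤ (a ℕ.+ b) c+d≤M) ≤N)
      where
      interchange : ∀ a c b d → a ℕ.+ c ℕ.+ (b ℕ.+ d) ≡ a ℕ.+ b ℕ.+ (c ℕ.+ d)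
      interchange = solve-∀

  record NonNeg (p : ℚ) : Set where
    constructor nonNeg
    field proof : NonNegative p
  open NonNeg

  infixl 6 _⊞_
  infixl 7 _⊠_

  _⊞_ : ∀ {p q} → NonNeg p → NonNeg q → NonNeg (p + q)
  _⊞_ {p} {q} (nonNeg p≥0) (nonNeg q≥0) = nonNeg (nonNeg+nonNeg⇒nonNeg p {{p≥0}} q {{q≥0}})

  _⊠_ : ∀ {p q} → NonNeg p → NonNeg q → NonNeg (p * q)
  _⊠_ {p} {q} (nonNeg p≥0) (nonNeg q≥0) = nonNeg (nonNeg*nonNeg⇒nonNeg p {{p≥0}} q {{q≥0}})

  nonNeg-nat : ∀ n → NonNeg (nat n)
  nonNeg-nat n = nonNeg (normalize-nonNeg n 1)

  nonNeg-∣∣ : ∀ p → NonNeg ∣ p ∣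
  nonNeg-∣∣ p = nonNeg (∣-∣-nonNeg p)

  nonNeg-∣∣+ : ∀ p → NonNeg (∣ p ∣ + p)
  nonNeg-∣∣+ p with ∣p∣≡p∨∣p∣≡-p p
  ... | inj₁ ∣p∣≡p  = subst NonNeg (cong (∣ p ∣ +_) ∣p∣≡p) (nonNeg-∣∣ p ⊞ nonNeg-∣∣ p)
  ... | inj₂ ∣p∣≡-p = subst NonNeg (sym (trans (cong (_+ p) ∣p∣≡-p) (+-inverseˡ p))) (nonNeg _)

  nonNeg-bounded-multiple : ∀ a N y → a ℕ.≤ N → NonNeg (nat N * ∣ y ∣ + nat a * y)
  nonNeg-bounded-multiple a N y a≤N =
    subst NonNeg regroup (nonNeg-nat (N ∸ a) ⊠ nonNeg-∣∣ y ⊞ nonNeg-nat a ⊠ nonNeg-∣∣+ y)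
    where
    regroup : nat (N ∸ a) * ∣ y ∣ + nat a * (∣ y ∣ + y) ≡ nat N * ∣ y ∣ + nat a * y
    regroup = trans
      (solve 4 (λ m a u y → m :* u :+ a :* (u :+ y) := (m :+ a) :* u :+ a :* y) refl (nat (N ∸ a)) (nat a) ∣ y ∣ y)
      (cong (λ t → t * ∣ y ∣ + nat a * y) (trans (sym (nat-+ (N ∸ a) a)) (cong nat (ℕ.m∸n+n≡m a≤N))))

  -- Large enough that w₀ + j · step N w₀ (j ≥ 1) exceeds −(a x + b z) whenever a + b ≤ N.
  step : ℕ → ℚ → ℚ
  step N w₀ = 1ℚ + (∣ w₀ ∣ + nat N * ∣ x ∣ + nat N * ∣ z ∣)

  regular-progression : ∀ N w₀ j → 1 ℕ.≤ j → Regular N (w₀ + nat j * step N w₀)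
  regular-progression N w₀ (suc j) _ = regular ℓ≢0-at
    where
    h = step N w₀
    ℓ≢0-at : ∀ a b → a ℕ.+ b ℕ.≤ N → ℓ a b (w₀ + nat (suc j) * h) ≢ 0ℚ
    ℓ≢0-at a b a+b≤N ℓ≡0 = <⇒≢ (positive⁻¹ (K + 1ℚ) {{K+1>0}}) (sym (trans K+1≡ℓ ℓ≡0))
      where
      K = (∣ w₀ ∣ + w₀) + (nat N * ∣ x ∣ + nat a * x) + (nat N * ∣ z ∣ + nat b * z) + nat j * h
      K≥0 : NonNeg K
      K≥0 = nonNeg-∣∣+ w₀
          ⊞ nonNeg-bounded-multiple a N x (ℕ.≤-trans (ℕ.m≤m+n a b) a+b≤N)
          ⊞ nonNeg-bounded-multiple b N z (ℕ.≤-trans (ℕ.m≤n+m b a) a+b≤N)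
          ⊞ nonNeg-nat j ⊠ (nonNeg {1ℚ} _ ⊞ (nonNeg-∣∣ w₀ ⊞ nonNeg-nat N ⊠ nonNeg-∣∣ x ⊞ nonNeg-nat N ⊠ nonNeg-∣∣ z))
      K+1>0 : Positive (K + 1ℚ)
      K+1>0 = nonNeg+pos⇒pos K {{proof K≥0}} 1ℚ
      K+1≡ℓ : K + 1ℚ ≡ ℓ a b (w₀ + nat (suc j) * h)
      K+1≡ℓ = trans
        (solve 8 (λ u w₀ nx ax nz bz j h → u :+ w₀ :+ (nx :+ ax) :+ (nz :+ bz) :+ j :* h :+ con 1ℚ
                                          := w₀ :+ (j :* h :+ (con 1ℚ :+ (u :+ nx :+ nz))) :+ ax :+ bz) refl
                 ∣ w₀ ∣ w₀ (nat N * ∣ x ∣) (nat a * x) (nat N * ∣ z ∣) (nat b * z) (nat j) h)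
        (cong (λ t → w₀ + t + nat a * x + nat b * z) jh+h≡[1+j]h)
        where
        jh+h≡[1+j]h : nat j * h + h ≡ nat (suc j) * h
        jh+h≡[1+j]h = trans (solve 2 (λ j h → j :* h :+ h := (con 1ℚ :+ j) :* h) refl (nat j) h) (cong (_* h) (sym (nat-+ 1 j)))

  record HasValue (P : RatFun) (w v : ℚ) : Set where
    constructor has-value
    field
      num≡ : num P w x z ≡ v * den P w x z
      den≢0 : den P w x z ≢ 0ℚ
  open HasValue public

  value-zero : ∀ w → HasValue zeroR w 0ℚ
  value-zero w = has-value refl λ ()

  value-one : ∀ w → HasValue oneR w 1ℚ
  value-one w = has-value refl λ ()

  value-lin : ∀ a b w → HasValue (lin a b) w (ℓ a b w)
  value-lin a b w = has-value (sym (*-identityʳ _)) λ ()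

  value-shift : ∀ a b {P w v} → HasValue P (ℓ a b w) v → HasValue (shift a b P) w v
  value-shift a b (has-value num≡ den≢0) = has-value num≡ den≢0

  value-⊕ : ∀ {P Q w u v} → HasValue P w u → HasValue Q w v → HasValue (P ⊕ Q) w (u + v)
  value-⊕ {P} {Q} {w} {u} {v} (has-value p≡ p≢0) (has-value q≡ q≢0) = has-value
    (trans (cong₂ _+_ (cong (_* den Q w x z) p≡) (cong (_* den P w x z) q≡))
           (solve 4 (λ u v p q → u :* p :* q :+ v :* q :* p := (u :+ v) :* (p :* q)) refl u v (den P w x z) (den Q w x z)))
    (*-≢0 p≢0 q≢0)

  value-⊖ : ∀ {P Q w u v} → HasValue P w u → HasValue Q w v → HasValue (P ⊖ Q) w (u - v)
  value-⊖ {P} {Q} {w} {u} {v} (has-value p≡ p≢0) (has-value q≡ q≢0) = has-value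
    (trans (cong₂ _-_ (cong (_* den Q w x z) p≡) (cong (_* den P w x z) q≡))
           (solve 4 (λ u v p q → u :* p :* q :- v :* q :* p := (u :- v) :* (p :* q)) refl u v (den P w x z) (den Q w x z)))
    (*-≢0 p≢0 q≢0)

  value-⊗ : ∀ {P Q w u v} → HasValue P w u → HasValue Q w v → HasValue (P ⊗ Q) w (u * v)
  value-⊗ {P} {Q} {w} {u} {v} (has-value p≡ p≢0) (has-value q≡ q≢0) = has-value
    (trans (cong₂ _*_ p≡ q≡)
           (solve 4 (λ u v p q → u :* p :* (v :* q) := (u :* v) :* (p :* q)) refl u v (den P w x z) (den Q w x z)))
    (*-≢0 p≢0 q≢0)

  value-⊘ : ∀ {P Q w u v} → HasValue P w u → HasValue Q w v → v ≢ 0ℚ → HasValue (P ⊘ Q) w (u * inv v)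
  value-⊘ {P} {Q} {w} {u} {v} (has-value p≡ p≢0) (has-value q≡ q≢0) v≢0 = has-value
    (begin
      num P w x z * dQ             ≡⟨ cong (_* dQ) p≡ ⟩
      u * dP * dQ                  ≡⟨ sym (*-cancelˡ-inv v (u * dP * dQ) v≢0) ⟩
      v * (u * dP * dQ * inv v)    ≡⟨ solve 5 (λ u p q v i → v :* (u :* p :* q :* i) := (u :* i) :* (p :* (v :* q))) refl u dP dQ v (inv v) ⟩
      (u * inv v) * (dP * (v * dQ))  ≡⟨ cong (λ t → (u * inv v) * (dP * t)) (sym q≡) ⟩
      (u * inv v) * (dP * num Q w x z) ∎)
    (*-≢0 p≢0 (λ numQ≡0 → *-≢0 v≢0 q≢0 (trans (sym q≡) numQ≡0)))
    where
    open ≡-Reasoning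
    dP = den P w x z
    dQ = den Q w x z

  value-sumR : ∀ m {F g w} → (∀ i → 1 ℕ.≤ i → i ℕ.≤ m → HasValue (F i) w (g i)) → HasValue (sumR m F) w (sumℚ m g)
  value-sumR zero    {w = w} values = value-zero w
  value-sumR (suc m) values = value-⊕ (value-sumR m (λ i 1≤i i≤m → values i 1≤i (ℕ.m≤n⇒m≤1+n i≤m)))
                                      (values (suc m) (s≤s z≤n) ℕ.≤-refl)

  -- Gf and Ff evaluated at a point: same fuel and clauses, with inv in place of ⊘.
  gval′ : ℕ → ℕ → ℚ → ℚ
  gval′ zero    n             w = 0ℚ
  gval′ (suc f) zero          w = 0ℚ
  gval′ (suc f) (suc zero)    w = 1ℚ * inv (ℓ 0 0 w)
  gval′ (suc f) (suc (suc m)) w =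
    sumℚ (suc m) (λ k → (gval′ f k w * gval′ f (suc (suc m) ∸ k) (ℓ 0 k w)) * inv (ℓ (suc m) 0 w))

  gval : ℕ → ℚ → ℚ
  gval n = gval′ n n

  fval′ : ℕ → ℕ → ℕ → ℚ → ℚ
  fval′ zero    k             n w = 0ℚ
  fval′ (suc f) zero          n w = 0ℚ
  fval′ (suc f) (suc zero)    n w = gval n w
  fval′ (suc f) (suc (suc j)) n w =
      sumℚ (n ∸ k ∸ 1) (λ i → (gval (n ∸ k ∸ i) (ℓ 0 (k ℕ.+ i) w) * fval′ f k (k ℕ.+ i) w) * inv (ℓ (n ∸ 1) 0 w))
    + sumℚ (k ∸ 1) (λ i → ((ℓ 0 i w * gval i (ℓ 1 0 w)) * fval′ f (k ∸ i) (n ∸ i) (ℓ 0 i w))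
                          * inv (ℓ 0 0 w * ℓ (n ∸ 1) 0 w))
    where k = suc (suc j)

  fval : ℕ → ℕ → ℚ → ℚ
  fval k n = fval′ n k n

  value-G : ∀ f n {w} → Regular n w → HasValue (Gf f n) w (gval′ f n w)
  value-G zero    n             {w} reg = value-zero w
  value-G (suc f) zero          {w} reg = value-zero w
  value-G (suc f) (suc zero)    {w} reg = value-⊘ (value-one w) (value-lin 0 0 w) (ℓ≢0 reg 0 0 z≤n)
  value-G (suc f) (suc (suc m)) {w} reg = value-sumR (suc m) λ k 1≤k k≤1+m →
    value-⊘ (value-⊗ (value-G f k (regular-mono (ℕ.m≤n⇒m≤1+n k≤1+m) reg))
                     (value-shift 0 k (value-G f (suc (suc m) ∸ k)
                                        (regular-ℓ 0 k (ℕ.≤-reflexive (ℕ.m+[n∸m]≡n (ℕ.m≤n⇒m≤1+n k≤1+m))) reg))))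
            (value-lin (suc m) 0 w)
            (ℓ≢0 reg (suc m) 0 (ℕ.≤-trans (ℕ.≤-reflexive (ℕ.+-identityʳ (suc m))) (ℕ.n≤1+n (suc m))))

  value-F : ∀ f k n {w} → k ℕ.≤ n → Regular n w → HasValue (Ff f k n) w (fval′ f k n w)
  value-F zero    k             n {w} k≤n reg = value-zero w
  value-F (suc f) zero          n {w} k≤n reg = value-zero w
  value-F (suc f) (suc zero)    n {w} k≤n reg = value-G n n reg
  value-F (suc f) (suc (suc j)) n {w} k≤n reg = value-⊕
    (value-sumR (n ∸ k ∸ 1) λ i 1≤i i≤ →
      value-⊘ (value-⊗ (value-shift 0 (k ℕ.+ i) (value-G (n ∸ k ∸ i) (n ∸ k ∸ i) (regular-ℓ 0 (k ℕ.+ i) (k+i+rest i i≤) reg)))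
                       (value-F f k (k ℕ.+ i) (ℕ.m≤m+n k i) (regular-mono (k+i≤n i i≤) reg)))
              (value-lin (n ∸ 1) 0 w) (ℓ≢0 reg (n ∸ 1) 0 n-1+0≤n))
    (value-sumR (k ∸ 1) λ i 1≤i i≤ →
      value-⊘ (value-⊗ (value-⊗ (value-lin 0 i w)
                                (value-shift 1 0 (value-G i i (regular-ℓ 1 0 (ℕ.≤-trans (s≤s i≤) k≤n) reg))))
                       (value-shift 0 i (value-F f (k ∸ i) (n ∸ i) (ℕ.∸-monoˡ-≤ i k≤n)
                                          (regular-ℓ 0 i (ℕ.≤-reflexive (ℕ.m+[n∸m]≡n (i≤n i i≤))) reg))))
              (value-⊗ (value-lin 0 0 w) (value-lin (n ∸ 1) 0 w))
              (*-≢0 (ℓ≢0 reg 0 0 z≤n) (ℓ≢0 reg (n ∸ 1) 0 n-1+0≤n)))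
    where
    k = suc (suc j)
    n-1+0≤n : n ∸ 1 ℕ.+ 0 ℕ.≤ n
    n-1+0≤n = ℕ.≤-trans (ℕ.≤-reflexive (ℕ.+-identityʳ (n ∸ 1))) (ℕ.m∸n≤m n 1)
    k+i≤n : ∀ i → i ℕ.≤ n ∸ k ∸ 1 → k ℕ.+ i ℕ.≤ n
    k+i≤n i i≤ = ℕ.≤-trans (ℕ.+-monoʳ-≤ k (ℕ.≤-trans i≤ (ℕ.m∸n≤m (n ∸ k) 1))) (ℕ.≤-reflexive (ℕ.m+[n∸m]≡n k≤n))
    k+i+rest : ∀ i → i ℕ.≤ n ∸ k ∸ 1 → k ℕ.+ i ℕ.+ (n ∸ k ∸ i) ℕ.≤ n
    k+i+rest i i≤ = ℕ.≤-reflexive (trans (cong (k ℕ.+ i ℕ.+_) (ℕ.∸-+-assoc n k i)) (ℕ.m+[n∸m]≡n (k+i≤n i i≤)))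
    i≤n : ∀ i → i ℕ.≤ k ∸ 1 → i ℕ.≤ n
    i≤n i i≤ = ℕ.≤-trans (ℕ.m≤n⇒m≤1+n i≤) k≤n

  record IsPolyFraction (P : RatFun) : Set where
    constructor poly-fraction
    field
      num-poly : IsPolynomial (λ w → num P w x z)
      den-poly : IsPolynomial (λ w → den P w x z)

  polyFraction-⊕ : ∀ {P Q} → IsPolyFraction P → IsPolyFraction Q → IsPolyFraction (P ⊕ Q)
  polyFraction-⊕ (poly-fraction p q) (poly-fraction r s) =
    poly-fraction (polynomial-+ (polynomial-* p s) (polynomial-* r q)) (polynomial-* q s)

  polyFraction-⊖ : ∀ {P Q} → IsPolyFraction P → IsPolyFraction Q → IsPolyFraction (P ⊖ Q)
  polyFraction-⊖ (poly-fraction p q) (poly-fraction r s) =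
    poly-fraction (polynomial-sub (polynomial-* p s) (polynomial-* r q)) (polynomial-* q s)

  polyFraction-⊗ : ∀ {P Q} → IsPolyFraction P → IsPolyFraction Q → IsPolyFraction (P ⊗ Q)
  polyFraction-⊗ (poly-fraction p q) (poly-fraction r s) = poly-fraction (polynomial-* p r) (polynomial-* q s)

  polyFraction-⊘ : ∀ {P Q} → IsPolyFraction P → IsPolyFraction Q → IsPolyFraction (P ⊘ Q)
  polyFraction-⊘ (poly-fraction p q) (poly-fraction r s) = poly-fraction (polynomial-* p s) (polynomial-* q r)

  polyFraction-zero : IsPolyFraction zeroR
  polyFraction-zero = poly-fraction (polynomial-const 0ℚ) (polynomial-const 1ℚ)

  polyFraction-one : IsPolyFraction oneR
  polyFraction-one = poly-fraction (polynomial-const 1ℚ) (polynomial-const 1ℚ)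

  polyFraction-lin : ∀ a b → IsPolyFraction (lin a b)
  polyFraction-lin a b = poly-fraction
    (polynomial-+ (polynomial-+ polynomial-id (polynomial-const (nat a * x))) (polynomial-const (nat b * z)))
    (polynomial-const 1ℚ)

  polyFraction-shift : ∀ a b {P} → IsPolyFraction P → IsPolyFraction (shift a b P)
  polyFraction-shift a b {P} (poly-fraction p q) = poly-fraction (shifted p) (shifted q)
    where
    shifted : ∀ {f} → IsPolynomial f → IsPolynomial (λ w → f (ℓ a b w))
    shifted {f} pf = polynomial-cong (λ w → cong f (sym (+-assoc w (nat a * x) (nat b * z))))
                                     (polynomial-shift (nat a * x + nat b * z) pf)

  polyFraction-sumR : ∀ m {F} → (∀ i → IsPolyFraction (F i)) → IsPolyFraction (sumR m F)
  polyFraction-sumR zero    polys = polyFraction-zero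
  polyFraction-sumR (suc m) polys = polyFraction-⊕ (polyFraction-sumR m polys) (polys (suc m))

  polyFraction-G : ∀ f n → IsPolyFraction (Gf f n)
  polyFraction-G zero    n             = polyFraction-zero
  polyFraction-G (suc f) zero          = polyFraction-zero
  polyFraction-G (suc f) (suc zero)    = polyFraction-⊘ polyFraction-one (polyFraction-lin 0 0)
  polyFraction-G (suc f) (suc (suc m)) = polyFraction-sumR (suc m) λ k →
    polyFraction-⊘ (polyFraction-⊗ (polyFraction-G f k) (polyFraction-shift 0 k (polyFraction-G f (suc (suc m) ∸ k))))
                   (polyFraction-lin (suc m) 0)

  polyFraction-F : ∀ f k n → IsPolyFraction (Ff f k n)
  polyFraction-F zero    k             n = polyFraction-zero
  polyFraction-F (suc f) zero          n = polyFraction-zero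
  polyFraction-F (suc f) (suc zero)    n = polyFraction-G n n
  polyFraction-F (suc f) (suc (suc j)) n = polyFraction-⊕
    (polyFraction-sumR (n ∸ k ∸ 1) λ i →
      polyFraction-⊘ (polyFraction-⊗ (polyFraction-shift 0 (k ℕ.+ i) (polyFraction-G (n ∸ k ∸ i) (n ∸ k ∸ i)))
                                     (polyFraction-F f k (k ℕ.+ i)))
                     (polyFraction-lin (n ∸ 1) 0))
    (polyFraction-sumR (k ∸ 1) λ i →
      polyFraction-⊘ (polyFraction-⊗ (polyFraction-⊗ (polyFraction-lin 0 i) (polyFraction-shift 1 0 (polyFraction-G i i)))
                                     (polyFraction-shift 0 i (polyFraction-F f (k ∸ i) (n ∸ i))))
                     (polyFraction-⊗ (polyFraction-lin 0 0) (polyFraction-lin (n ∸ 1) 0)))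
    where k = suc (suc j)

  -- Cross-multiplied, P ≈ Q says that a polynomial in w vanishes; at the regular points
  -- w₀ + j · step N w₀ (j ≥ 1) it does, so by progression-zeros⇒zero it vanishes at w₀ too.
  agree-at-regular⇒cross-equal : ∀ N {P Q} → IsPolyFraction P → IsPolyFraction Q →
    (∀ w → Regular N w → Σ ℚ λ v → HasValue P w v × HasValue Q w v) →
    ∀ w → num P w x z * den Q w x z ≡ num Q w x z * den P w x z
  agree-at-regular⇒cross-equal N {P} {Q} (poly-fraction p q) (poly-fraction r s) agree w₀ =
    x∙y⁻¹≈ε⇒x≈y _ _ (progression-zeros⇒zero (proj₁ cross-poly) w₀ (step N w₀) (proj₂ cross-poly) λ j 1≤j _ →
                       cross-zero-at-regular (regular-progression N w₀ j 1≤j))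
    where
    cross : ℚ → ℚ
    cross w = num P w x z * den Q w x z - num Q w x z * den P w x z
    cross-poly : IsPolynomial cross
    cross-poly = polynomial-sub (polynomial-* p s) (polynomial-* r q)
    cross-zero-at-regular : ∀ {w} → Regular N w → cross w ≡ 0ℚ
    cross-zero-at-regular {w} reg with agree w reg
    ... | v , has-value p≡ _ , has-value q≡ _ = begin
      cross w                                          ≡⟨ cong₂ (λ a b → a * den Q w x z - b * den P w x z) p≡ q≡ ⟩
      v * den P w x z * den Q w x z - v * den Q w x z * den P w x z
        ≡⟨ solve 3 (λ v p q → v :* p :* q :- v :* q :* p := con 0ℚ) refl v (den P w x z) (den Q w x z) ⟩
      0ℚ                                               ∎
      where open ≡-Reasoning

module Identity (x z : ℚ) where
  open import Data.Nat as ℕ using (ℕ; zero; suc; z≤n; s≤s; _∸_)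
  import Data.Nat.Properties as ℕ
  open import Data.Product using (Σ; _,_; _×_)
  open import Data.Nat.Induction using (<-rec)
  open import Data.Empty using (⊥-elim)
  open import Data.Rational using (0ℚ; 1ℚ; _+_; _-_; _*_)
  open import Data.Rational.Properties
  open import Data.Rational.Solver using (module +-*-Solver)
  open import Relation.Binary.PropositionalEquality
  open import Data.Nat.Tactic.RingSolver using (solve-∀)
  open +-*-Solver
  open RationalArithmetic
  open Evaluation x z

  1+n∸k≤n : ∀ n {k} → 1 ℕ.≤ k → suc n ∸ k ℕ.≤ n
  1+n∸k≤n n {suc k} _ = ℕ.m∸n≤m n k

  k+i<n : ∀ {k n i} → k ℕ.< n → i ℕ.≤ n ∸ k ∸ 1 → k ℕ.+ i ℕ.< n
  k+i<n {k} {n} {i} k<n i≤ = ℕ.≤-trans (ℕ.≤-reflexive (reorder k i))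
    (ℕ.m≤o∸n⇒m+n≤o i (ℕ.≤-trans (ℕ.≤-reflexive (ℕ.+-comm k 1)) k<n)
                      (ℕ.≤-trans i≤ (ℕ.≤-reflexive (ℕ.∸-+-assoc n k 1))))
    where
    reorder : ∀ k i → suc (k ℕ.+ i) ≡ i ℕ.+ (k ℕ.+ 1)
    reorder = solve-∀

  gval′-fuel : ∀ f f′ n w → n ℕ.≤ f → n ℕ.≤ f′ → gval′ f n w ≡ gval′ f′ n w
  gval′-fuel zero    zero     zero          w _ _ = refl
  gval′-fuel zero    (suc f′) zero          w _ _ = refl
  gval′-fuel (suc f) zero     zero          w _ _ = refl
  gval′-fuel (suc f) (suc f′) zero          w _ _ = refl
  gval′-fuel (suc f) (suc f′) (suc zero)    w _ _ = refl
  gval′-fuel (suc f) (suc f′) (suc (suc m)) w (s≤s 1+m≤f) (s≤s 1+m≤f′) =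
    sumℚ-cong (suc m) λ k 1≤k k≤1+m →
      cong (_* inv (ℓ (suc m) 0 w))
           (cong₂ _*_ (gval′-fuel f f′ k w (ℕ.≤-trans k≤1+m 1+m≤f) (ℕ.≤-trans k≤1+m 1+m≤f′))
                      (gval′-fuel f f′ (suc (suc m) ∸ k) (ℓ 0 k w) (ℕ.≤-trans (1+n∸k≤n (suc m) 1≤k) 1+m≤f)
                                                                  (ℕ.≤-trans (1+n∸k≤n (suc m) 1≤k) 1+m≤f′)))

  fval′-fuel : ∀ f f′ k n w → k ℕ.< n → n ℕ.≤ f → n ℕ.≤ f′ → fval′ f k n w ≡ fval′ f′ k n w
  fval′-fuel zero    f′       k n w k<n n≤f n≤f′ = ⊥-elim (ℕ.n≮0 (ℕ.<-≤-trans k<n n≤f))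
  fval′-fuel (suc f) zero     k n w k<n n≤f n≤f′ = ⊥-elim (ℕ.n≮0 (ℕ.<-≤-trans k<n n≤f′))
  fval′-fuel (suc f) (suc f′) zero          n w _ _ _ = refl
  fval′-fuel (suc f) (suc f′) (suc zero)    n w _ _ _ = refl
  fval′-fuel (suc f) (suc f′) (suc (suc j)) n w k<n n≤1+f n≤1+f′ = cong₂ _+_
    (sumℚ-cong (n ∸ k ∸ 1) λ i 1≤i i≤ →
      cong (λ t → (gval (n ∸ k ∸ i) (ℓ 0 (k ℕ.+ i) w) * t) * inv (ℓ (n ∸ 1) 0 w))
           (fval′-fuel f f′ k (k ℕ.+ i) w (ℕ.m<m+n k 1≤i) (ℕ.≤-pred (ℕ.≤-trans (k+i<n k<n i≤) n≤1+f))
                                                         (ℕ.≤-pred (ℕ.≤-trans (k+i<n k<n i≤) n≤1+f′))))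
    (sumℚ-cong (k ∸ 1) λ i 1≤i i≤ →
      cong (λ t → ((ℓ 0 i w * gval i (ℓ 1 0 w)) * t) * inv (ℓ 0 0 w * ℓ (n ∸ 1) 0 w))
           (fval′-fuel f f′ (k ∸ i) (n ∸ i) (ℓ 0 i w) (ℕ.∸-monoˡ-< k<n (ℕ.m≤n⇒m≤1+n i≤))
                       (n∸i≤ 1≤i n≤1+f) (n∸i≤ 1≤i n≤1+f′)))
    where
    k = suc (suc j)
    n∸i≤ : ∀ {i m} → 1 ℕ.≤ i → n ℕ.≤ suc m → n ∸ i ℕ.≤ m
    n∸i≤ 1≤i n≤1+m = ℕ.≤-trans (ℕ.∸-monoʳ-≤ n 1≤i) (ℕ.∸-monoˡ-≤ 1 n≤1+m)

  gval-1 : ∀ v → gval 1 v ≡ inv v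
  gval-1 v = trans (*-identityˡ _) (cong inv (ℓ-0-0 v))

  G-convolution : ℕ → ℚ → ℚ
  G-convolution n v = sumℚ (n ∸ 1) (λ k → gval k v * gval (n ∸ k) (ℓ 0 k v))

  gval-rec : ∀ m v → gval (suc (suc m)) v ≡ G-convolution (suc (suc m)) v * inv (ℓ (suc m) 0 v)
  gval-rec m v = trans
    (sumℚ-cong (suc m) λ k 1≤k k≤1+m →
      cong (_* inv (ℓ (suc m) 0 v))
           (cong₂ _*_ (gval′-fuel (suc m) k k v k≤1+m ℕ.≤-refl)
                      (gval′-fuel (suc m) (suc (suc m) ∸ k) (suc (suc m) ∸ k) (ℓ 0 k v) (1+n∸k≤n (suc m) 1≤k) ℕ.≤-refl)))
    (sumℚ-*ʳ (suc m) _ _)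

  G-convolution≡ℓ*gval : ∀ m v → ℓ (suc m) 0 v ≢ 0ℚ →
    G-convolution (suc (suc m)) v ≡ ℓ (suc m) 0 v * gval (suc (suc m)) v
  G-convolution≡ℓ*gval m v ℓ≢0 = sym (trans (cong (ℓ (suc m) 0 v *_) (gval-rec m v)) (*-cancelˡ-inv _ _ ℓ≢0))

  G-convolution-tail : ∀ t u → ℓ (suc t) 0 u ≢ 0ℚ →
    sumℚ t (λ i → gval (suc i) u * gval (suc t ∸ i) (ℓ 0 (suc i) u))
      ≡ ℓ (suc t) 0 u * gval (suc (suc t)) u - inv u * gval (suc t) (ℓ 0 1 u)
  G-convolution-tail t u ℓ≢0 = begin
    S                                                ≡⟨ solve 2 (λ a S → S := (a :+ S) :- a) refl first S ⟩
    (first + S) - first                              ≡⟨ cong (_- first) (sym (sumℚ-suc t _)) ⟩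
    G-convolution (suc (suc t)) u - first            ≡⟨ cong₂ _-_ (G-convolution≡ℓ*gval t u ℓ≢0)
                                                                  (cong (_* gval (suc t) (ℓ 0 1 u)) (gval-1 u)) ⟩
    ℓ (suc t) 0 u * gval (suc (suc t)) u - inv u * gval (suc t) (ℓ 0 1 u)  ∎
    where
    open ≡-Reasoning
    S = sumℚ t (λ i → gval (suc i) u * gval (suc t ∸ i) (ℓ 0 (suc i) u))
    first = gval 1 u * gval (suc t) (ℓ 0 1 u)

  -- The two sums in the recursion for F_{k,n}, without their denominators; m = n − k.
  tail-convolution : ℕ → ℕ → ℚ → ℚ
  tail-convolution k m w = sumℚ (m ∸ 1) (λ i → gval (m ∸ i) (ℓ 0 (k ℕ.+ i) w) * fval k (k ℕ.+ i) w)

  shift-convolution : ℕ → ℕ → ℚ → ℚ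
  shift-convolution k n w = sumℚ (k ∸ 1) (λ i → (ℓ 0 i w * gval i (ℓ 1 0 w)) * fval (k ∸ i) (n ∸ i) (ℓ 0 i w))

  fval-rec : ∀ k n w → 2 ℕ.≤ k → k ℕ.< n →
    fval k n w ≡ tail-convolution k (n ∸ k) w * inv (ℓ (n ∸ 1) 0 w) + shift-convolution k n w * inv (ℓ 0 0 w * ℓ (n ∸ 1) 0 w)
  fval-rec (suc (suc j)) (suc f) w (s≤s (s≤s z≤n)) k<n = cong₂ _+_
    (trans (sumℚ-cong (n ∸ k ∸ 1) λ i 1≤i i≤ →
             cong (λ t → (gval (n ∸ k ∸ i) (ℓ 0 (k ℕ.+ i) w) * t) * inv (ℓ (n ∸ 1) 0 w))
                  (fval′-fuel f (k ℕ.+ i) k (k ℕ.+ i) w (ℕ.m<m+n k 1≤i) (ℕ.≤-pred (k+i<n k<n i≤)) ℕ.≤-refl))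
           (sumℚ-*ʳ (n ∸ k ∸ 1) _ _))
    (trans (sumℚ-cong (k ∸ 1) λ i 1≤i i≤ →
             cong (λ t → ((ℓ 0 i w * gval i (ℓ 1 0 w)) * t) * inv (ℓ 0 0 w * ℓ (n ∸ 1) 0 w))
                  (fval′-fuel f (n ∸ i) (k ∸ i) (n ∸ i) (ℓ 0 i w) (ℕ.∸-monoˡ-< k<n (ℕ.m≤n⇒m≤1+n i≤))
                              (ℕ.∸-monoʳ-≤ n 1≤i) ℕ.≤-refl))
           (sumℚ-*ʳ (k ∸ 1) _ _))
    where
    k = suc (suc j)
    n = suc f

  ℓ-1-0-ℓ-0-i : ∀ i w → ℓ 1 0 (ℓ 0 i w) ≡ ℓ 0 i (ℓ 1 0 w)
  ℓ-1-0-ℓ-0-i i w = trans (ℓ-ℓ 1 0 0 i w) (trans (cong (λ t → ℓ 1 t w) (ℕ.+-identityʳ i)) (sym (ℓ-ℓ 0 i 1 0 w)))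

  ℓ-0-[k∸i]-ℓ-0-i : ∀ i k w → i ℕ.≤ k → ℓ 0 (k ∸ i) (ℓ 0 i w) ≡ ℓ 0 k w
  ℓ-0-[k∸i]-ℓ-0-i i k w i≤k = trans (ℓ-ℓ 0 (k ∸ i) 0 i w) (cong (λ t → ℓ 0 t w) (ℕ.m+[n∸m]≡n i≤k))

  FSucFormula : ℕ → Set
  FSucFormula k = ∀ {w} → 1 ℕ.≤ k → Regular (k ℕ.+ 1) w →
    fval k (k ℕ.+ 1) w ≡ gval k (ℓ 1 0 w) * inv (ℓ 0 0 w) * inv (ℓ 0 k w)

  fval-suc : ∀ k → FSucFormula k
  fval-suc = <-rec FSucFormula step-case
    where
    step-case : ∀ k → (∀ {k′} → k′ ℕ.< k → FSucFormula k′) → FSucFormula k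
    step-case (suc zero) _ {w} _ reg = begin
      gval 2 w
        ≡⟨ gval-rec 0 w ⟩
      (0ℚ + gval 1 w * gval 1 (ℓ 0 1 w)) * inv (ℓ 1 0 w)
        ≡⟨ cong₂ (λ a b → (0ℚ + a * b) * inv (ℓ 1 0 w)) (gval-1 w) (gval-1 (ℓ 0 1 w)) ⟩
      (0ℚ + inv w * inv (ℓ 0 1 w)) * inv (ℓ 1 0 w)
        ≡⟨ solve 3 (λ a b c → (con 0ℚ :+ a :* b) :* c := c :* a :* b) refl (inv w) (inv (ℓ 0 1 w)) (inv (ℓ 1 0 w)) ⟩
      inv (ℓ 1 0 w) * inv w * inv (ℓ 0 1 w)
        ≡⟨ sym (cong₂ (λ a b → a * inv b * inv (ℓ 0 1 w)) (gval-1 (ℓ 1 0 w)) (ℓ-0-0 w)) ⟩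
      gval 1 (ℓ 1 0 w) * inv (ℓ 0 0 w) * inv (ℓ 0 1 w)  ∎
      where open ≡-Reasoning
    step-case (suc (suc j)) rec {w} _ reg = begin
      fval k (k ℕ.+ 1) w
        ≡⟨ fval-rec k (k ℕ.+ 1) w (s≤s (s≤s z≤n)) (ℕ.≤-reflexive (ℕ.+-comm 1 k)) ⟩
      tail-convolution k (k ℕ.+ 1 ∸ k) w * inv (ℓ (k ℕ.+ 1 ∸ 1) 0 w)
        + shift-convolution k (k ℕ.+ 1) w * inv (ℓ 0 0 w * ℓ (k ℕ.+ 1 ∸ 1) 0 w)
        ≡⟨ cong₂ (λ m n → tail-convolution k m w * inv (ℓ n 0 w) + shift-convolution k (k ℕ.+ 1) w * inv (ℓ 0 0 w * ℓ n 0 w))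
                 (ℕ.m+n∸m≡n k 1) (ℕ.m+n∸n≡m k 1) ⟩
      0ℚ * inv (ℓ k 0 w) + shift-convolution k (k ℕ.+ 1) w * inv (ℓ 0 0 w * ℓ k 0 w)
        ≡⟨ cong₂ (λ a b → a + shift-convolution k (k ℕ.+ 1) w * b) (*-zeroˡ (inv (ℓ k 0 w))) (inv-* (ℓ 0 0 w) (ℓ k 0 w)) ⟩
      0ℚ + shift-convolution k (k ℕ.+ 1) w * (inv (ℓ 0 0 w) * inv (ℓ k 0 w))
        ≡⟨ cong (λ s → 0ℚ + s * (inv (ℓ 0 0 w) * inv (ℓ k 0 w))) (sumℚ-cong (suc j) summand) ⟩
      0ℚ + sumℚ (suc j) (λ i → gval i v * gval (k ∸ i) (ℓ 0 i v) * inv u) * (inv (ℓ 0 0 w) * inv (ℓ k 0 w))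
        ≡⟨ cong (λ s → 0ℚ + s * (inv (ℓ 0 0 w) * inv (ℓ k 0 w))) (sumℚ-*ʳ (suc j) _ (inv u)) ⟩
      0ℚ + G-convolution k v * inv u * (inv (ℓ 0 0 w) * inv (ℓ k 0 w))
        ≡⟨ cong (λ s → 0ℚ + s * inv u * (inv (ℓ 0 0 w) * inv (ℓ k 0 w)))
                (G-convolution≡ℓ*gval j v (subst (_≢ 0ℚ) (sym (ℓ-ℓ (suc j) 0 1 0 w)) w+kx≢0)) ⟩
      0ℚ + ℓ (suc j) 0 v * gval k v * inv u * (inv (ℓ 0 0 w) * inv (ℓ k 0 w))
        ≡⟨ cong (λ a → 0ℚ + a * gval k v * inv u * (inv (ℓ 0 0 w) * inv (ℓ k 0 w))) (ℓ-ℓ (suc j) 0 1 0 w) ⟩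
      0ℚ + ℓ k 0 w * gval k v * inv u * (inv (ℓ 0 0 w) * inv (ℓ k 0 w))
        ≡⟨ solve 5 (λ a g iu iw ia → con 0ℚ :+ a :* g :* iu :* (iw :* ia) := a :* (g :* iw :* iu :* ia)) refl
                   (ℓ k 0 w) (gval k v) (inv u) (inv (ℓ 0 0 w)) (inv (ℓ k 0 w)) ⟩
      ℓ k 0 w * (gval k v * inv (ℓ 0 0 w) * inv u * inv (ℓ k 0 w))
        ≡⟨ *-cancelˡ-inv (ℓ k 0 w) _ w+kx≢0 ⟩
      gval k v * inv (ℓ 0 0 w) * inv u  ∎
      where
      open ≡-Reasoning
      k = suc (suc j)
      v = ℓ 1 0 w
      u = ℓ 0 k w
      w+kx≢0 : ℓ k 0 w ≢ 0ℚ
      w+kx≢0 = ℓ≢0 reg k 0 (ℕ.+-monoʳ-≤ k z≤n)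
      summand : ∀ i → 1 ℕ.≤ i → i ℕ.≤ suc j →
        (ℓ 0 i w * gval i v) * fval (k ∸ i) (k ℕ.+ 1 ∸ i) (ℓ 0 i w) ≡ gval i v * gval (k ∸ i) (ℓ 0 i v) * inv u
      summand i 1≤i i≤1+j = begin
        (si * gval i v) * fval (k ∸ i) (k ℕ.+ 1 ∸ i) si
          ≡⟨ cong (λ a → (si * gval i v) * fval (k ∸ i) a si) (ℕ.+-∸-comm 1 i≤k) ⟩
        (si * gval i v) * fval (k ∸ i) (k ∸ i ℕ.+ 1) si
          ≡⟨ cong ((si * gval i v) *_) inner ⟩
        (si * gval i v) * (gval (k ∸ i) (ℓ 0 i v) * inv si * inv u)
          ≡⟨ solve 5 (λ s g h is iu → (s :* g) :* (h :* is :* iu) := s :* (g :* h :* iu :* is)) refl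
                     si (gval i v) (gval (k ∸ i) (ℓ 0 i v)) (inv si) (inv u) ⟩
        si * (gval i v * gval (k ∸ i) (ℓ 0 i v) * inv u * inv si)
          ≡⟨ *-cancelˡ-inv si _ (ℓ≢0 reg 0 i (ℕ.≤-trans i≤k (ℕ.m≤m+n k 1))) ⟩
        gval i v * gval (k ∸ i) (ℓ 0 i v) * inv u  ∎
        where
        si = ℓ 0 i w
        i≤k : i ℕ.≤ k
        i≤k = ℕ.m≤n⇒m≤1+n i≤1+j
        inner : fval (k ∸ i) (k ∸ i ℕ.+ 1) si ≡ gval (k ∸ i) (ℓ 0 i v) * inv si * inv u
        inner = begin
          fval (k ∸ i) (k ∸ i ℕ.+ 1) si
            ≡⟨ rec (ℕ.∸-monoʳ-< 1≤i i≤k) (ℕ.m<n⇒0<n∸m (s≤s i≤1+j))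
                   (regular-ℓ 0 i (ℕ.≤-reflexive (trans (sym (ℕ.+-assoc i (k ∸ i) 1)) (cong (ℕ._+ 1) (ℕ.m+[n∸m]≡n i≤k)))) reg) ⟩
          gval (k ∸ i) (ℓ 1 0 si) * inv (ℓ 0 0 si) * inv (ℓ 0 (k ∸ i) si)
            ≡⟨ cong₂ (λ a b → gval (k ∸ i) a * inv b * inv (ℓ 0 (k ∸ i) si)) (ℓ-1-0-ℓ-0-i i w) (ℓ-0-0 si) ⟩
          gval (k ∸ i) (ℓ 0 i v) * inv si * inv (ℓ 0 (k ∸ i) si)
            ≡⟨ cong (λ c → gval (k ∸ i) (ℓ 0 i v) * inv si * inv c) (ℓ-0-[k∸i]-ℓ-0-i i k w i≤k) ⟩
          gval (k ∸ i) (ℓ 0 i v) * inv si * inv u  ∎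

  DifferenceIdentity : ℕ → Set
  DifferenceIdentity n = ∀ k {w} → 1 ℕ.≤ k → k ℕ.+ 2 ℕ.≤ n → Regular n w →
    fval k n w - fval (k ℕ.+ 1) n w ≡ gval k (ℓ 1 0 w) * gval (n ∸ k) (ℓ 0 k w) * inv (ℓ 0 0 w)

  -- The i-th terms of the two tail convolutions differ by an instance of the identity for n = k + 1 + i;
  -- the leftover first term is F_{k,k+1}, and the resulting sum is the recursion for G_{n−k}(w + k z).
  tail-convolution-difference : ∀ k t {w} → 1 ℕ.≤ k → Regular (k ℕ.+ suc (suc t)) w →
    (∀ {m} → m ℕ.< k ℕ.+ suc (suc t) → DifferenceIdentity m) →
    tail-convolution k (suc (suc t)) w - tail-convolution (k ℕ.+ 1) (suc t) w
      ≡ gval k (ℓ 1 0 w) * (ℓ (suc t) 0 (ℓ 0 k w) * gval (suc (suc t)) (ℓ 0 k w)) * inv (ℓ 0 0 w)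
  tail-convolution-difference k t {w} 1≤k reg ih = begin
    sumℚ (suc t) f - sumℚ t g
      ≡⟨ cong (_- sumℚ t g) (sumℚ-suc t f) ⟩
    (f 1 + sumℚ t (λ i → f (suc i))) - sumℚ t g
      ≡⟨ solve 3 (λ a b c → (a :+ b) :- c := a :+ (b :- c)) refl (f 1) (sumℚ t (λ i → f (suc i))) (sumℚ t g) ⟩
    f 1 + (sumℚ t (λ i → f (suc i)) - sumℚ t g)
      ≡⟨ cong (f 1 +_) (trans (sumℚ-sub t _ _) (sumℚ-cong t term)) ⟩
    f 1 + sumℚ t (λ i → gval (suc i) u * gval (suc t ∸ i) (ℓ 0 (suc i) u) * K)
      ≡⟨ cong (f 1 +_) (trans (sumℚ-*ʳ t _ K) (cong (_* K) (G-convolution-tail t u u+[1+t]x≢0))) ⟩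
    f 1 + (ℓ (suc t) 0 u * Gu - inv u * gval (suc t) (ℓ 0 1 u)) * K
      ≡⟨ cong (_+ (ℓ (suc t) 0 u * Gu - inv u * gval (suc t) (ℓ 0 1 u)) * K) first-term ⟩
    gval (suc t) (ℓ 0 1 u) * (gval k v * inv (ℓ 0 0 w) * inv u) + (ℓ (suc t) 0 u * Gu - inv u * gval (suc t) (ℓ 0 1 u)) * K
      ≡⟨ solve 6 (λ G g iw iu a h → G :* (g :* iw :* iu) :+ (a :* h :- iu :* G) :* (g :* iw) := g :* (a :* h) :* iw) refl
                 (gval (suc t) (ℓ 0 1 u)) (gval k v) (inv (ℓ 0 0 w)) (inv u) (ℓ (suc t) 0 u) Gu ⟩
    gval k v * (ℓ (suc t) 0 u * Gu) * inv (ℓ 0 0 w)  ∎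
    where
    open ≡-Reasoning
    v = ℓ 1 0 w
    u = ℓ 0 k w
    Gu = gval (suc (suc t)) u
    K = gval k v * inv (ℓ 0 0 w)
    f g : ℕ → ℚ
    f i = gval (suc (suc t) ∸ i) (ℓ 0 (k ℕ.+ i) w) * fval k (k ℕ.+ i) w
    g i = gval (suc t ∸ i) (ℓ 0 (k ℕ.+ 1 ℕ.+ i) w) * fval (k ℕ.+ 1) (k ℕ.+ 1 ℕ.+ i) w
    ℓ-0-i-u : ∀ i → ℓ 0 i u ≡ ℓ 0 (k ℕ.+ i) w
    ℓ-0-i-u i = ℓ-ℓ 0 i 0 k w
    k+1+i : ∀ i → k ℕ.+ suc i ≡ k ℕ.+ 1 ℕ.+ i
    k+1+i i = sym (ℕ.+-assoc k 1 i)
    u+[1+t]x≢0 : ℓ (suc t) 0 u ≢ 0ℚ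
    u+[1+t]x≢0 = subst (_≢ 0ℚ) (sym (ℓ-ℓ (suc t) 0 0 k w))
                   (ℓ≢0 reg (suc t) (k ℕ.+ 0) (ℕ.≤-trans (ℕ.≤-reflexive (reorder t k)) (ℕ.+-monoʳ-≤ k (ℕ.n≤1+n (suc t)))))
      where
      reorder : ∀ t k → suc t ℕ.+ (k ℕ.+ 0) ≡ k ℕ.+ suc t
      reorder = solve-∀
    first-term : f 1 ≡ gval (suc t) (ℓ 0 1 u) * (gval k v * inv (ℓ 0 0 w) * inv u)
    first-term = cong₂ (λ a b → gval (suc t) a * b) (sym (ℓ-0-i-u 1))
                       (fval-suc k 1≤k (regular-mono (ℕ.+-monoʳ-≤ k (s≤s z≤n)) reg))
    term : ∀ i → 1 ℕ.≤ i → i ℕ.≤ t → f (suc i) - g i ≡ gval (suc i) u * gval (suc t ∸ i) (ℓ 0 (suc i) u) * K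
    term i 1≤i i≤t = begin
      f (suc i) - g i
        ≡⟨ cong (λ m → gval (suc t ∸ i) (ℓ 0 m w) * fval k m w - g i) (k+1+i i) ⟩
      P * fval k m w - P * fval (k ℕ.+ 1) m w
        ≡⟨ solve 3 (λ P a b → P :* a :- P :* b := P :* (a :- b)) refl P (fval k m w) (fval (k ℕ.+ 1) m w) ⟩
      P * (fval k m w - fval (k ℕ.+ 1) m w)
        ≡⟨ cong (P *_) (trans (ih m<n k 1≤k k+2≤m (regular-mono (ℕ.<⇒≤ m<n) reg))
                              (cong (λ d → gval k v * gval d u * inv (ℓ 0 0 w)) m∸k≡1+i)) ⟩
      P * (gval k v * gval (suc i) u * inv (ℓ 0 0 w))
        ≡⟨ solve 4 (λ P g h iw → P :* (g :* h :* iw) := h :* P :* (g :* iw)) refl P (gval k v) (gval (suc i) u) (inv (ℓ 0 0 w)) ⟩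
      gval (suc i) u * P * K
        ≡⟨ cong (λ p → gval (suc i) u * gval (suc t ∸ i) p * K) (sym (trans (ℓ-0-i-u (suc i)) (cong (λ q → ℓ 0 q w) (k+1+i i)))) ⟩
      gval (suc i) u * gval (suc t ∸ i) (ℓ 0 (suc i) u) * K  ∎
      where
      m = k ℕ.+ 1 ℕ.+ i
      P = gval (suc t ∸ i) (ℓ 0 m w)
      m<n : m ℕ.< k ℕ.+ suc (suc t)
      m<n = subst (ℕ._< k ℕ.+ suc (suc t)) (k+1+i i) (ℕ.+-monoʳ-< k (s≤s (s≤s i≤t)))
      k+2≤m : k ℕ.+ 2 ℕ.≤ m
      k+2≤m = subst (k ℕ.+ 2 ℕ.≤_) (k+1+i i) (ℕ.+-monoʳ-≤ k (s≤s 1≤i))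
      m∸k≡1+i : m ∸ k ≡ suc i
      m∸k≡1+i = trans (cong (_∸ k) (sym (k+1+i i))) (ℕ.m+n∸m≡n k (suc i))

  fval-1 : ∀ m {u} → 1 ℕ.≤ m → fval 1 m u ≡ gval m u
  fval-1 (suc m) _ = refl

  -- The i-th terms of the two shift convolutions differ by an instance of the identity at (k − i, n − i) and the point w + i z,
  -- and the extra last term of the second sum is (w + k z) G_k(w + x) F_{1,n−k}(w + k z).
  shift-convolution-difference : ∀ k n {w} → 2 ℕ.≤ k → k ℕ.+ 2 ℕ.≤ n → Regular n w →
    (∀ {m} → m ℕ.< n → DifferenceIdentity m) →
    shift-convolution k n w - shift-convolution (k ℕ.+ 1) n w
      ≡ gval k (ℓ 1 0 w) * gval (n ∸ k) (ℓ 0 k w) * (ℓ k 0 w - ℓ 0 k w)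
  shift-convolution-difference (suc (suc j)) n {w} (s≤s (s≤s z≤n)) k+2≤n reg ih = begin
    shift-convolution k n w - shift-convolution (k ℕ.+ 1) n w
      ≡⟨ cong (λ m → shift-convolution k n w - sumℚ m T′) (ℕ.m+n∸n≡m k 1) ⟩
    sumℚ (suc j) T - (sumℚ (suc j) T′ + T′ k)
      ≡⟨ solve 3 (λ a b c → a :- (b :+ c) := (a :- b) :- c) refl (sumℚ (suc j) T) (sumℚ (suc j) T′) (T′ k) ⟩
    (sumℚ (suc j) T - sumℚ (suc j) T′) - T′ k
      ≡⟨ cong (_- T′ k) (trans (sumℚ-sub (suc j) T T′) (trans (sumℚ-cong (suc j) summand) (sumℚ-*ʳ (suc j) _ Gu))) ⟩
    G-convolution k v * Gu - T′ k
      ≡⟨ cong₂ (λ a b → a * Gu - (u * gval k v) * b) (G-convolution≡ℓ*gval j v v+[1+j]x≢0)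
               (trans (cong (λ a → fval a (n ∸ k) u) (ℕ.m+n∸m≡n k 1)) (fval-1 (n ∸ k) (ℕ.m<n⇒0<n∸m k<n))) ⟩
    ℓ (suc j) 0 v * gval k v * Gu - (u * gval k v) * Gu
      ≡⟨ cong (λ a → a * gval k v * Gu - (u * gval k v) * Gu) (ℓ-ℓ (suc j) 0 1 0 w) ⟩
    ℓ k 0 w * gval k v * Gu - (u * gval k v) * Gu
      ≡⟨ solve 4 (λ a g Gu u → a :* g :* Gu :- (u :* g) :* Gu := g :* Gu :* (a :- u)) refl (ℓ k 0 w) (gval k v) Gu u ⟩
    gval k v * Gu * (ℓ k 0 w - u)  ∎
    where
    open ≡-Reasoning
    k = suc (suc j)
    v = ℓ 1 0 w
    u = ℓ 0 k w
    Gu = gval (n ∸ k) u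
    k<n : k ℕ.< n
    k<n = ℕ.≤-trans (ℕ.≤-reflexive (ℕ.+-comm 1 k)) (ℕ.≤-trans (ℕ.+-monoʳ-≤ k (ℕ.n≤1+n 1)) k+2≤n)
    T T′ : ℕ → ℚ
    T  i = (ℓ 0 i w * gval i v) * fval (k ∸ i) (n ∸ i) (ℓ 0 i w)
    T′ i = (ℓ 0 i w * gval i v) * fval (k ℕ.+ 1 ∸ i) (n ∸ i) (ℓ 0 i w)
    v+[1+j]x≢0 : ℓ (suc j) 0 v ≢ 0ℚ
    v+[1+j]x≢0 = subst (_≢ 0ℚ) (sym (ℓ-ℓ (suc j) 0 1 0 w))
                       (ℓ≢0 reg k 0 (ℕ.≤-trans (ℕ.≤-reflexive (ℕ.+-identityʳ k)) (ℕ.<⇒≤ k<n)))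
    summand : ∀ i → 1 ℕ.≤ i → i ℕ.≤ suc j → T i - T′ i ≡ (gval i v * gval (k ∸ i) (ℓ 0 i v)) * Gu
    summand i 1≤i i≤1+j = begin
      T i - T′ i
        ≡⟨ cong (λ m → T i - (si * gval i v) * fval m (n ∸ i) si) (ℕ.+-∸-comm 1 i≤k) ⟩
      (si * gval i v) * fval (k ∸ i) (n ∸ i) si - (si * gval i v) * fval (k ∸ i ℕ.+ 1) (n ∸ i) si
        ≡⟨ solve 3 (λ c a b → c :* a :- c :* b := c :* (a :- b)) refl
                   (si * gval i v) (fval (k ∸ i) (n ∸ i) si) (fval (k ∸ i ℕ.+ 1) (n ∸ i) si) ⟩
      (si * gval i v) * (fval (k ∸ i) (n ∸ i) si - fval (k ∸ i ℕ.+ 1) (n ∸ i) si)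
        ≡⟨ cong ((si * gval i v) *_)
                (trans (ih n∸i<n (k ∸ i) 1≤k∸i k∸i+2≤n∸i (regular-ℓ 0 i i+[n∸i]≤n reg))
                       (rename-args (ℓ-1-0-ℓ-0-i i w) n∸i∸[k∸i]≡n∸k (ℓ-0-[k∸i]-ℓ-0-i i k w i≤k) (ℓ-0-0 si))) ⟩
      (si * gval i v) * (gval (k ∸ i) (ℓ 0 i v) * Gu * inv si)
        ≡⟨ solve 5 (λ s g h Gu is → (s :* g) :* (h :* Gu :* is) := s :* ((g :* h) :* Gu :* is)) refl
                   si (gval i v) (gval (k ∸ i) (ℓ 0 i v)) Gu (inv si) ⟩
      si * ((gval i v * gval (k ∸ i) (ℓ 0 i v)) * Gu * inv si)
        ≡⟨ *-cancelˡ-inv si _ (ℓ≢0 reg 0 i i≤n) ⟩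
      (gval i v * gval (k ∸ i) (ℓ 0 i v)) * Gu  ∎
      where
      si = ℓ 0 i w
      i≤k : i ℕ.≤ k
      i≤k = ℕ.m≤n⇒m≤1+n i≤1+j
      i≤n : i ℕ.≤ n
      i≤n = ℕ.≤-trans i≤k (ℕ.<⇒≤ k<n)
      n∸i<n : n ∸ i ℕ.< n
      n∸i<n = ℕ.∸-monoʳ-< 1≤i i≤n
      1≤k∸i : 1 ℕ.≤ k ∸ i
      1≤k∸i = ℕ.m<n⇒0<n∸m (s≤s i≤1+j)
      k∸i+2≤n∸i : k ∸ i ℕ.+ 2 ℕ.≤ n ∸ i
      k∸i+2≤n∸i = ℕ.≤-trans (ℕ.≤-reflexive (sym (ℕ.+-∸-comm 2 i≤k))) (ℕ.∸-monoˡ-≤ i k+2≤n)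
      i+[n∸i]≤n : i ℕ.+ (n ∸ i) ℕ.≤ n
      i+[n∸i]≤n = ℕ.≤-reflexive (ℕ.m+[n∸m]≡n i≤n)
      n∸i∸[k∸i]≡n∸k : n ∸ i ∸ (k ∸ i) ≡ n ∸ k
      n∸i∸[k∸i]≡n∸k = trans (ℕ.∸-+-assoc n i (k ∸ i)) (cong (n ∸_) (ℕ.m+[n∸m]≡n i≤k))
      rename-args : ∀ {a a′ b b′ c c′ d d′} → a ≡ a′ → b ≡ b′ → c ≡ c′ → d ≡ d′ →
                    gval (k ∸ i) a * gval b c * inv d ≡ gval (k ∸ i) a′ * gval b′ c′ * inv d′
      rename-args refl refl refl refl = refl

  difference-split : ∀ k t {w} → 1 ℕ.≤ k → Regular (k ℕ.+ suc (suc t)) w →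
    (∀ {m} → m ℕ.< k ℕ.+ suc (suc t) → DifferenceIdentity m) →
    fval k (k ℕ.+ suc (suc t)) w - fval (k ℕ.+ 1) (k ℕ.+ suc (suc t)) w
      ≡ (tail-convolution k (suc (suc t)) w - tail-convolution (k ℕ.+ 1) (suc t) w) * inv (ℓ (k ℕ.+ suc (suc t) ∸ 1) 0 w)
        + gval k (ℓ 1 0 w) * gval (suc (suc t)) (ℓ 0 k w) * (ℓ k 0 w - ℓ 0 k w) * inv (ℓ 0 0 w * ℓ (k ℕ.+ suc (suc t) ∸ 1) 0 w)
  difference-split (suc zero) t {w} _ reg _ = begin
    gval n w - fval 2 n w
      ≡⟨ cong₂ _-_ G-split (trans (fval-rec 2 n w (s≤s (s≤s z≤n)) (s≤s (s≤s (s≤s z≤n))))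
                                  (cong (λ s → T₂ * iL + s * iwL) (+-identityˡ ((u * gval 1 v) * Gu)))) ⟩
    (T₁ * iL + inv w * Gu * iL) - (T₂ * iL + (u * gval 1 v) * Gu * iwL)
      ≡⟨ cong₂ (λ a b → (T₁ * iL + inv w * Gu * iL) - (T₂ * iL + (u * a) * Gu * b)) (gval-1 v) (inv-* (ℓ 0 0 w) L) ⟩
    (T₁ * iL + inv w * Gu * iL) - (T₂ * iL + (u * inv v) * Gu * (inv (ℓ 0 0 w) * iL))
      ≡⟨ cong (λ a → (T₁ * iL + inv w * Gu * iL) - (T₂ * iL + (u * inv v) * Gu * (inv a * iL))) (ℓ-0-0 w) ⟩
    (T₁ * iL + inv w * Gu * iL) - (T₂ * iL + (u * inv v) * Gu * (inv w * iL))
      ≡⟨ cong (λ o → (T₁ * iL + o * Gu * iL) - (T₂ * iL + (u * inv v) * Gu * (inv w * iL)))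
              (sym (trans (cong (_* inv w) (inv-inverseʳ v v≢0)) (*-identityˡ (inv w)))) ⟩
    (T₁ * iL + (v * inv v) * inv w * Gu * iL) - (T₂ * iL + (u * inv v) * Gu * (inv w * iL))
      ≡⟨ solve 8 (λ T₁ T₂ iL v iv iw G u → (T₁ :* iL :+ (v :* iv) :* iw :* G :* iL) :- (T₂ :* iL :+ (u :* iv) :* G :* (iw :* iL))
                                          := (T₁ :- T₂) :* iL :+ iv :* G :* (v :- u) :* (iw :* iL)) refl
                 T₁ T₂ iL v (inv v) (inv w) Gu u ⟩
    (T₁ - T₂) * iL + inv v * Gu * (v - u) * (inv w * iL)
      ≡⟨ cong₂ (λ a b → (T₁ - T₂) * iL + a * Gu * (v - u) * b) (sym (gval-1 v))
               (trans (cong (λ a → inv a * iL) (sym (ℓ-0-0 w))) (sym (inv-* (ℓ 0 0 w) L))) ⟩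
    (T₁ - T₂) * iL + gval 1 v * Gu * (v - u) * iwL  ∎
    where
    open ≡-Reasoning
    n = suc (suc (suc t))
    v = ℓ 1 0 w
    u = ℓ 0 1 w
    L = ℓ (suc (suc t)) 0 w
    iL = inv L
    iwL = inv (ℓ 0 0 w * L)
    Gu = gval (suc (suc t)) u
    T₁ = tail-convolution 1 (suc (suc t)) w
    T₂ = tail-convolution 2 (suc t) w
    v≢0 : v ≢ 0ℚ
    v≢0 = ℓ≢0 reg 1 0 (s≤s z≤n)
    G-split : gval n w ≡ T₁ * iL + inv w * Gu * iL
    G-split = begin
      gval n w                                  ≡⟨ gval-rec (suc t) w ⟩
      G-convolution n w * iL                    ≡⟨ cong (_* iL) (sumℚ-suc (suc t) _) ⟩
      (gval 1 w * Gu + S) * iL                  ≡⟨ cong (λ a → (a * Gu + S) * iL) (gval-1 w) ⟩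
      (inv w * Gu + S) * iL                     ≡⟨ solve 4 (λ a G S i → (a :* G :+ S) :* i := S :* i :+ a :* G :* i) refl (inv w) Gu S iL ⟩
      S * iL + inv w * Gu * iL                  ≡⟨ cong (λ s → s * iL + inv w * Gu * iL)
                                                        (sumℚ-cong (suc t) λ i _ _ → *-comm (gval (suc i) w) _) ⟩
      T₁ * iL + inv w * Gu * iL                 ∎
      where
      S = sumℚ (suc t) (λ i → gval (suc i) w * gval (suc (suc t) ∸ i) (ℓ 0 (suc i) w))
  difference-split (suc (suc j)) t {w} _ reg ih = begin
    fval k n w - fval (k ℕ.+ 1) n w
      ≡⟨ cong₂ _-_ (fval-rec k n w (s≤s (s≤s z≤n)) k<n) (fval-rec (k ℕ.+ 1) n w (s≤s (s≤s z≤n)) k+1<n) ⟩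
    (tail-convolution k (n ∸ k) w * iL + shift-convolution k n w * iwL)
      - (tail-convolution (k ℕ.+ 1) (n ∸ (k ℕ.+ 1)) w * iL + shift-convolution (k ℕ.+ 1) n w * iwL)
      ≡⟨ cong₂ (λ a b → (tail-convolution k a w * iL + shift-convolution k n w * iwL)
                        - (tail-convolution (k ℕ.+ 1) b w * iL + shift-convolution (k ℕ.+ 1) n w * iwL))
               n∸k≡2+t n∸[k+1]≡1+t ⟩
    (Tk * iL + Sk * iwL) - (Tk+1 * iL + Sk+1 * iwL)
      ≡⟨ solve 6 (λ a b c d i j → (a :* i :+ b :* j) :- (c :* i :+ d :* j) := (a :- c) :* i :+ (b :- d) :* j) refl Tk Sk Tk+1 Sk+1 iL iwL ⟩
    (Tk - Tk+1) * iL + (Sk - Sk+1) * iwL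
      ≡⟨ cong (λ s → (Tk - Tk+1) * iL + s * iwL)
              (trans (shift-convolution-difference k n (s≤s (s≤s z≤n)) (ℕ.+-monoʳ-≤ k (s≤s (s≤s z≤n))) reg ih)
                     (cong (λ m → gval k (ℓ 1 0 w) * gval m (ℓ 0 k w) * (ℓ k 0 w - ℓ 0 k w)) n∸k≡2+t)) ⟩
    (Tk - Tk+1) * iL + gval k (ℓ 1 0 w) * gval (suc (suc t)) (ℓ 0 k w) * (ℓ k 0 w - ℓ 0 k w) * iwL  ∎
    where
    open ≡-Reasoning
    k = suc (suc j)
    n = k ℕ.+ suc (suc t)
    iL = inv (ℓ (n ∸ 1) 0 w)
    iwL = inv (ℓ 0 0 w * ℓ (n ∸ 1) 0 w)
    Tk = tail-convolution k (suc (suc t)) w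
    Tk+1 = tail-convolution (k ℕ.+ 1) (suc t) w
    Sk = shift-convolution k n w
    Sk+1 = shift-convolution (k ℕ.+ 1) n w
    n∸k≡2+t : n ∸ k ≡ suc (suc t)
    n∸k≡2+t = ℕ.m+n∸m≡n k (suc (suc t))
    n∸[k+1]≡1+t : n ∸ (k ℕ.+ 1) ≡ suc t
    n∸[k+1]≡1+t = trans (cong (_∸ (k ℕ.+ 1)) (sym (ℕ.+-assoc k 1 (suc t)))) (ℕ.m+n∸m≡n (k ℕ.+ 1) (suc t))
    k<n : k ℕ.< n
    k<n = ℕ.m<m+n k (s≤s z≤n)
    k+1<n : k ℕ.+ 1 ℕ.< n
    k+1<n = subst (k ℕ.+ 1 ℕ.<_) (ℕ.+-assoc k 1 (suc t)) (ℕ.m<m+n (k ℕ.+ 1) (s≤s z≤n))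

  -- The two parts of the split combine because (w + k z + (n−k−1) x) + (w + k x) − (w + k z) = w + (n−1) x.
  difference-step : ∀ k t {w} → 1 ℕ.≤ k → Regular (k ℕ.+ suc (suc t)) w →
    (∀ {m} → m ℕ.< k ℕ.+ suc (suc t) → DifferenceIdentity m) →
    fval k (k ℕ.+ suc (suc t)) w - fval (k ℕ.+ 1) (k ℕ.+ suc (suc t)) w
      ≡ gval k (ℓ 1 0 w) * gval (k ℕ.+ suc (suc t) ∸ k) (ℓ 0 k w) * inv (ℓ 0 0 w)
  difference-step (suc k₀) t {w} 1≤k reg ih = begin
    fval k n w - fval (k ℕ.+ 1) n w
      ≡⟨ difference-split k t 1≤k reg ih ⟩
    (tail-convolution k (suc (suc t)) w - tail-convolution (k ℕ.+ 1) (suc t) w) * iL + gk * Gu * (ℓ k 0 w - u) * inv (ℓ 0 0 w * L)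
      ≡⟨ cong₂ (λ a b → a * iL + gk * Gu * (ℓ k 0 w - u) * b) (tail-convolution-difference k t 1≤k reg ih) (inv-* (ℓ 0 0 w) L) ⟩
    gk * (ℓ (suc t) 0 u * Gu) * iw * iL + gk * Gu * (ℓ k 0 w - u) * (iw * iL)
      ≡⟨ solve 7 (λ gk Gu iw iL a b u → gk :* (a :* Gu) :* iw :* iL :+ gk :* Gu :* (b :- u) :* (iw :* iL)
                                     := gk :* Gu :* iw :* ((a :+ b :- u) :* iL)) refl
                 gk Gu iw iL (ℓ (suc t) 0 u) (ℓ k 0 w) u ⟩
    gk * Gu * iw * ((ℓ (suc t) 0 u + ℓ k 0 w - u) * iL)
      ≡⟨ cong (λ a → gk * Gu * iw * (a * iL)) forms-sum ⟩
    gk * Gu * iw * (L * iL)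
      ≡⟨ cong (gk * Gu * iw *_) (inv-inverseʳ L L≢0) ⟩
    gk * Gu * iw * 1ℚ
      ≡⟨ *-identityʳ _ ⟩
    gk * Gu * iw
      ≡⟨ cong (λ m → gk * gval m u * iw) (sym (ℕ.m+n∸m≡n k (suc (suc t)))) ⟩
    gk * gval (n ∸ k) u * iw  ∎
    where
    open ≡-Reasoning
    k = suc k₀
    n = k ℕ.+ suc (suc t)
    u = ℓ 0 k w
    gk = gval k (ℓ 1 0 w)
    Gu = gval (suc (suc t)) u
    L = ℓ (n ∸ 1) 0 w
    iL = inv L
    iw = inv (ℓ 0 0 w)
    L≢0 : L ≢ 0ℚ
    L≢0 = ℓ≢0 reg (n ∸ 1) 0 (ℕ.≤-trans (ℕ.≤-reflexive (ℕ.+-identityʳ (n ∸ 1))) (ℕ.m∸n≤m n 1))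
    forms-sum : ℓ (suc t) 0 u + ℓ k 0 w - u ≡ L
    forms-sum = trans
      (solve 5 (λ w a b x z → (w :+ con 0ℚ :* x :+ b :* z) :+ a :* x :+ con 0ℚ :* z :+ (w :+ b :* x :+ con 0ℚ :* z)
                              :- (w :+ con 0ℚ :* x :+ b :* z)
                              := w :+ (a :+ b) :* x :+ con 0ℚ :* z) refl w (nat (suc t)) (nat k) x z)
      (cong (λ c → w + c * x + 0ℚ * z) (trans (sym (nat-+ (suc t) k)) (cong nat (reorder t k₀))))
      where
      reorder : ∀ t k₀ → suc t ℕ.+ suc k₀ ≡ k₀ ℕ.+ suc (suc t)
      reorder = solve-∀

  difference-identity : ∀ n → DifferenceIdentity n
  difference-identity = <-rec DifferenceIdentity induction-step
    where
    induction-step : ∀ n → (∀ {m} → m ℕ.< n → DifferenceIdentity m) → DifferenceIdentity n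
    induction-step n ih k {w} 1≤k k+2≤n reg = subst Goal n≡k+[2+t] (difference-step k t 1≤k) reg ih
      where
      t = n ∸ (k ℕ.+ 2)
      n≡k+[2+t] : k ℕ.+ suc (suc t) ≡ n
      n≡k+[2+t] = trans (sym (ℕ.+-assoc k 2 t)) (ℕ.m+[n∸m]≡n k+2≤n)
      Goal : ℕ → Set
      Goal m = Regular m w → (∀ {m′} → m′ ℕ.< m → DifferenceIdentity m′) →
               fval k m w - fval (k ℕ.+ 1) m w ≡ gval k (ℓ 1 0 w) * gval (m ∸ k) (ℓ 0 k w) * inv (ℓ 0 0 w)

  sides-agree-at-regular : ∀ k n {w} → 1 ℕ.≤ k → k ℕ.+ 2 ℕ.≤ n → Regular n w →
    Σ ℚ λ v → HasValue (F k n ⊖ F (k ℕ.+ 1) n) w v × HasValue ((shift 1 0 (G k) ⊗ shift 0 k (G (n ∸ k))) ⊘ W) w v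
  sides-agree-at-regular k n {w} 1≤k k+2≤n reg =
      _
    , value-⊖ (value-F n k n k≤n reg) (value-F n (k ℕ.+ 1) n k+1≤n reg)
    , subst (HasValue _ w) (sym (difference-identity n k 1≤k k+2≤n reg))
        (value-⊘ (value-⊗ (value-shift 1 0 (value-G k k (regular-ℓ 1 0 (ℕ.≤-trans (ℕ.≤-reflexive (ℕ.+-comm 1 k)) k+1≤n) reg)))
                          (value-shift 0 k (value-G (n ∸ k) (n ∸ k) (regular-ℓ 0 k (ℕ.≤-reflexive (ℕ.m+[n∸m]≡n k≤n)) reg))))
                 (value-lin 0 0 w) (ℓ≢0 reg 0 0 z≤n))
    where
    k+1≤n : k ℕ.+ 1 ℕ.≤ n
    k+1≤n = ℕ.≤-trans (ℕ.+-monoʳ-≤ k (ℕ.n≤1+n 1)) k+2≤n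
    k≤n : k ℕ.≤ n
    k≤n = ℕ.≤-trans (ℕ.m≤m+n k 1) k+1≤n

open import Data.Nat using (ℕ; _≤_; _+_; _∸_)

theorem2p3 : (k n : ℕ) → 1 ≤ k → k + 2 ≤ n →
    F k n ⊖ F (k + 1) n ≈ (shift 1 0 (G k) ⊗ shift 0 k (G (n ∸ k))) ⊘ W
theorem2p3 k n 1≤k k+2≤n w x z =
  agree-at-regular⇒cross-equal n
    (polyFraction-⊖ (polyFraction-F n k n) (polyFraction-F n (k + 1) n))
    (polyFraction-⊘ (polyFraction-⊗ (polyFraction-shift 1 0 (polyFraction-G k k))
                                    (polyFraction-shift 0 k (polyFraction-G (n ∸ k) (n ∸ k))))
                    (polyFraction-lin 0 0))
    (λ _ → sides-agree-at-regular k n 1≤k k+2≤n)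
    w
  where
  open Evaluation x z
  open Identity x z
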